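{- Let $k \geq 0$ be an integer and let $b, c$ be non-zero integers such that: (1) $b \geq -2$; (2) $3 \nmid bc$; (3) if $b$ is even, then $c$ is even; (4) if $b$ is odd and there exists an integer $x$ with $2 \cdot 3^k < 2^x < 3^{k+1}$, $2^x \leq |b|$, and $(b \bmod 2^x) \equiv 0 \pmod 3$, then $c$ is even; (5) for every prime $p$ with $2 \cdot 3^k < p < 3^{k+1}$, $p \leq |b|$, and $(b \bmod p) \equiv 0 \pmod 3$, we have $p \mid c$. Let $q_t(n) = 3c n^2 + bc n$ for $n \geq 0$. Then for every positive integer $m < 3^{k+1}$ there exist integers $i, j$ with $0 \leq i < j \leq 3^k$ such that $m \mid q_t(j) - q_t(i)$.
   Context: For integers $a$ and $N \geq 1$, $a \bmod N$ denotes the least non-negative residue of $a$ modulo $N$. -}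

module Defs where

open import Data.Nat as ℕ using (ℕ; NonZero)
open import Data.Nat.Properties using (m^n≢0)
open import Data.Nat.Primality using (Prime; prime⇒nonZero)
open import Data.Integer as ℤ using (ℤ; +_; _%ℕ_)

_mod2^_ : ℤ → ℕ → ℕ
b mod2^ x = _%ℕ_ b (2 ℕ.^ x) {{m^n≢0 2 x}}

modPrime : ℤ → (p : ℕ) → Prime p → ℕ
modPrime b p pp = _%ℕ_ b p {{prime⇒nonZero pp}}

qt : ℤ → ℤ → ℕ → ℤ
qt b c n = ℤ.+ 3 ℤ.* c ℤ.* (+ n) ℤ.* (+ n) ℤ.+ b ℤ.* c ℤ.* (+ n)

{-# OPTIONS --safe #-}
-- Since q(x + t) − q(x) = c·t·(3(2x + t) + b), it suffices to find x and t ≥ 1 with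
-- x + t ≤ N = 3ᵏ and m ∣ c·t·(3s + b), where s = 2x + t; one splits m = u·v with u ∣ c·t
-- and v ∣ 3s + b. For 3 ∤ v the congruence 3s + b ≡ 0 (mod v) has a root in every window
-- of v consecutive integers, and a root s in a suitable window is written as 2x + t with
-- t = d or t = 2d, for a prescribed odd d, according to the parity of s.
-- Besides m ≤ N (take t = m), such windows settle 3 ∤ m < 2N and m = 3^β·m₁ with
-- 0 < β < k (taking d = 3^β), while m = 2N uses the parity of 3N + b. For 2N < m < 3N with 3 ∤ m: an odd composite m = d·e
-- takes t = e; an odd prime m either divides c by (5) or the least root of 3s + b modulo m
-- lies below 2N, which is what the condition on b mod m guarantees; an even m uses that
-- c is even by (3) or (4), or m = 2r with r odd, or m = 2ᵃ·r with t = 2ᵃ and a ≥ 2.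
module Submission where

open import Defs
open import Data.Nat as ℕ using (ℕ; _^_; _≤_; _<_)
open import Data.Nat.Primality using (Prime)
open import Data.Integer as ℤ using (ℤ; +_; -[1+_]; ∣_∣)
open import Data.Integer.Divisibility using () renaming (_∣_ to _∣ℤ_)
open import Data.Nat.Divisibility using () renaming (_∣_ to _∣ℕ_)
open import Data.Product using (Σ; _×_)
open import Relation.Binary.PropositionalEquality using (_≡_)
open import Relation.Nullary using (¬_)

import Data.Integer.Properties as ℤP
open import Data.Nat.Properties using (+-comm)
open import Data.Product using (_,_)
open import Relation.Binary.PropositionalEquality
  using (_≢_; refl; sym; trans; cong; cong₂; subst; subst₂; module ≡-Reasoning)

module Arithmetic where
  open import Data.Nat using (zero; suc; _+_; _*_; z≤n; s≤s; NonZero; >-nonZero; >-nonZero⁻¹)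
  open import Data.Nat.Properties
  open import Data.Nat.Divisibility
    using (_∣_; divides; _∣?_; _∣0; ∣-refl; ∣-trans; ∣1⇒≡1; ∣m+n∣m⇒∣n; m∣m*n)
  open import Data.Nat.Coprimality using (Coprime; coprime-divisor)
  open import Data.Nat.Primality using (prime?; prime[2]; prime⇒irreducible)
  open import Data.Nat.Induction using (<-rec)
  open import Data.Nat.Tactic.RingSolver using (solve)
  open import Data.List using (_∷_; [])
  open import Data.Sum using (inj₁; inj₂)
  open import Relation.Nullary using (yes; no; contradiction)
  open import Relation.Nullary.Decidable using (from-yes)

  data Parity : ℕ → Set where
    even : ∀ h → Parity (h + h)
    odd  : ∀ h → Parity (suc (h + h))

  parity : ∀ n → Parity n
  parity zero = even 0
  parity (suc n) with parity n
  ... | even h = odd h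
  ... | odd h = subst Parity (cong suc (+-suc h h)) (even (suc h))

  2∣h+h : ∀ h → 2 ∣ h + h
  2∣h+h h = divides h (solve (h ∷ []))

  2∤odd : ∀ h → ¬ 2 ∣ suc (h + h)
  2∤odd h (divides q eq) = even≢odd q h (trans (solve (q ∷ [])) (trans (sym eq) (solve (h ∷ []))))

  half-≤ : ∀ {m n} → m + m ≤ suc (n + n) → m ≤ n
  half-≤ {m} {n} le = ≮⇒≥ λ n<m → n≮n (n + n)
    (≤-pred (subst (_≤ suc (n + n)) (cong suc (+-suc n n)) (≤-trans (+-mono-≤ n<m n<m) le)))

  split-2x+t : ∀ {N s} z → let d = suc (z + z) in d + d ≤ suc s → s + (d + d) ≤ suc (N + N) →
               Σ ℕ λ x → Σ ℕ λ t → d ∣ t × 0 < t × x + t ≤ N × x + x + t ≡ s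
  split-2x+t {N} {s} z lo hi with parity s
  ... | odd y with m≤n⇒∃[o]m+o≡n {z} {y} (m+n≤o⇒m≤o z (half-≤ 2z≤y))
    where
    2z≤y : (z + z) + (z + z) ≤ suc (y + y)
    2z≤y = ≤-trans (n≤1+n _) (≤-pred (begin
      suc (suc ((z + z) + (z + z)))   ≡⟨ solve (z ∷ []) ⟩
      suc (z + z) + suc (z + z)       ≤⟨ lo ⟩
      suc (suc (y + y))               ∎))
      where open ≤-Reasoning
  ...   | x , refl = x , suc (z + z) , divides 1 (solve (z ∷ [])) , s≤s z≤n , half-≤ (begin
          (x + suc (z + z)) + (x + suc (z + z))                ≤⟨ m≤m+n _ (suc (z + z)) ⟩
          (x + suc (z + z)) + (x + suc (z + z)) + suc (z + z)  ≡⟨ solve (x ∷ z ∷ []) ⟩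
          suc (z + x + (z + x)) + (suc (z + z) + suc (z + z))  ≤⟨ hi ⟩
          suc (N + N)                                          ∎) , solve (x ∷ z ∷ [])
    where open ≤-Reasoning
  split-2x+t {N} {s} z lo hi | even y with m≤n⇒∃[o]m+o≡n {suc (z + z)} {y} (half-≤ lo)
  ...   | x , refl = x , suc (z + z) + suc (z + z) , divides 2 (solve (z ∷ [])) , s≤s z≤n , half-≤ (begin
          (x + (suc (z + z) + suc (z + z))) + (x + (suc (z + z) + suc (z + z)))
            ≡⟨ solve (x ∷ z ∷ []) ⟩
          (suc (z + z) + x + (suc (z + z) + x)) + (suc (z + z) + suc (z + z))
            ≤⟨ hi ⟩
          suc (N + N) ∎) , solve (x ∷ z ∷ [])
    where open ≤-Reasoning

  ∤⇒nonZero : ∀ {d n} → ¬ d ∣ n → NonZero n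
  ∤⇒nonZero {d} {zero} d∤0 = contradiction (d ∣0) d∤0
  ∤⇒nonZero {n = suc n} _ = _

  ∤⇒0< : ∀ {d n} → ¬ d ∣ n → 0 < n
  ∤⇒0< d∤n = >-nonZero⁻¹ _ {{∤⇒nonZero d∤n}}

  prime[3] : Prime 3
  prime[3] = from-yes (prime? 3)

  prime∤⇒coprime : ∀ {p n} → Prime p → ¬ p ∣ n → Coprime p n
  prime∤⇒coprime pp p∤n (d∣p , d∣n) with prime⇒irreducible pp d∣p
  ... | inj₁ d≡1 = d≡1
  ... | inj₂ refl = contradiction d∣n p∤n

  coprime-* : ∀ {m n o} → Coprime m o → Coprime n o → Coprime (m * n) o
  coprime-* m⊥o n⊥o (e∣mn , e∣o) =
    n⊥o (coprime-divisor (λ (g∣e , g∣m) → m⊥o (g∣m , ∣-trans g∣e e∣o)) e∣mn , e∣o)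

  coprime-6 : ∀ {d} → ¬ 2 ∣ d → ¬ 3 ∣ d → Coprime 6 d
  coprime-6 2∤d 3∤d = coprime-* (prime∤⇒coprime prime[2] 2∤d) (prime∤⇒coprime prime[3] 3∤d)

  4≤-coprime-6 : ∀ {d} → 1 < d → ¬ 2 ∣ d → ¬ 3 ∣ d → 4 ≤ d
  4≤-coprime-6 {1} (s≤s ()) _ _
  4≤-coprime-6 {2} _ 2∤d _ = contradiction ∣-refl 2∤d
  4≤-coprime-6 {3} _ _ 3∤d = contradiction ∣-refl 3∤d
  4≤-coprime-6 {suc (suc (suc (suc d)))} _ _ _ = s≤s (s≤s (s≤s (s≤s z≤n)))

  2m<3n⇒m<2n : ∀ {m n} → 2 * m < 3 * n → m < n + n
  2m<3n⇒m<2n {m} {n} 2m<3n = *-cancelˡ-< 2 _ _ (<-≤-trans 2m<3n (begin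
    3 * n        ≤⟨ m≤n+m (3 * n) n ⟩
    n + 3 * n    ≡⟨ solve (n ∷ []) ⟩
    2 * (n + n)  ∎))
    where open ≤-Reasoning

  multiple-below : ∀ {m X} j → m ∣ X → X < suc j * m → X ≤ j * m
  multiple-below {m} j (divides q refl) X<[1+j]m =
    *-monoˡ-≤ m (≤-pred (*-cancelʳ-< m q (suc j) X<[1+j]m))

  between-N-and-3N⇒2N : ∀ {N m} → N ∣ m → N < m → m < 3 * N → m ≡ 2 * N
  between-N-and-3N⇒2N {N} (divides j refl) N<jN jN<3N
    with *-cancelʳ-< N 1 j (subst (_< j * N) (sym (*-identityˡ N)) N<jN) | *-cancelʳ-< N j 3 jN<3N
  ... | s≤s (s≤s z≤n) | s≤s (s≤s (s≤s z≤n)) = refl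

  3-adic-bound : ∀ {X Y f} → 3 ≤ X → 3 ≤ Y → f < 3 * Y → f + 4 * X ≤ 2 * (X * Y) + 3
  3-adic-bound {X} {Y} {f} 3≤X 3≤Y f<3Y with m≤n⇒∃[o]m+o≡n 3≤X | m≤n⇒∃[o]m+o≡n 3≤Y
  ... | p , refl | q , refl = ≤-pred (begin
    suc f + 4 * (3 + p)                                           ≤⟨ +-monoˡ-≤ _ f<3Y ⟩
    3 * (3 + q) + 4 * (3 + p)                                     ≤⟨ m≤m+n _ _ ⟩
    3 * (3 + q) + 4 * (3 + p) + (1 + 2 * p + 3 * q + 2 * p * q)   ≡⟨ solve (p ∷ q ∷ []) ⟩
    suc (2 * ((3 + p) * (3 + q)) + 3)                             ∎)
    where open ≤-Reasoning

  sum≤-of-product : ∀ {d e N} → 4 ≤ d → 4 ≤ e → 8 ≤ N → d * e < 3 * N → d + e ≤ suc N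
  sum≤-of-product {d} {e} {N} 4≤d 4≤e 8≤N de<3N
    with m≤n⇒∃[o]m+o≡n 4≤d | m≤n⇒∃[o]m+o≡n 4≤e
  ... | p , refl | q , refl = ≮⇒≥ λ N+1<d+e → <⇒≱ de<3N (+-cancelʳ-≤ 16 _ _ (begin
    3 * N + (8 + 8)                   ≤⟨ +-monoʳ-≤ (3 * N) (+-monoˡ-≤ 8 8≤N) ⟩
    3 * N + (N + 8)                   ≡⟨ solve (N ∷ []) ⟩
    4 * suc (suc N)                   ≤⟨ *-monoʳ-≤ 4 N+1<d+e ⟩
    4 * ((4 + p) + (4 + q))           ≤⟨ m≤m+n _ (p * q) ⟩
    4 * ((4 + p) + (4 + q)) + p * q   ≡⟨ solve (p ∷ q ∷ []) ⟩
    (4 + p) * (4 + q) + 16            ∎))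
    where open ≤-Reasoning

  factor-out : ∀ {p} → 1 < p → ∀ m → 0 < m → Σ ℕ λ a → Σ ℕ λ r → m ≡ p ^ a * r × ¬ p ∣ r
  factor-out {p} 1<p = <-rec _ step
    where
    Factorisation : ℕ → Set
    Factorisation m = Σ ℕ λ a → Σ ℕ λ r → m ≡ p ^ a * r × ¬ p ∣ r
    step : ∀ m → (∀ {q} → q < m → 0 < q → Factorisation q) → 0 < m → Factorisation m
    step m rec 0<m with p ∣? m
    ... | no p∤m = 0 , m , sym (+-identityʳ m) , p∤m
    ... | yes (divides zero refl) = contradiction 0<m (n≮n 0)
    ... | yes (divides q@(suc _) refl) with rec (m<m*n q p 1<p) (s≤s z≤n)
    ...   | a , r , q≡pᵃr , p∤r = suc a , r , qp≡pᵃ⁺¹r , p∤r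
      where
      qp≡pᵃ⁺¹r : q * p ≡ p ^ suc a * r
      qp≡pᵃ⁺¹r = trans (cong (_* p) q≡pᵃr) (trans (*-comm (p ^ a * r) p) (sym (*-assoc p (p ^ a) r)))

  ^-monoʳ-∣ : ∀ p {m n} → m ≤ n → p ^ m ∣ p ^ n
  ^-monoʳ-∣ p {m} {n} m≤n with m≤n⇒∃[o]m+o≡n m≤n
  ... | o , refl = divides (p ^ o) (trans (^-distribˡ-+-* p m o) (*-comm (p ^ m) (p ^ o)))

  2∤3^ : ∀ k → ¬ 2 ∣ 3 ^ k
  2∤3^ zero 2∣1 = contradiction (∣1⇒≡1 2∣1) λ ()
  2∤3^ (suc k) 2∣3ᵏ⁺¹ = 2∤3^ k (∣m+n∣m⇒∣n (subst (2 ∣_) (3n≡2n+n (3 ^ k)) 2∣3ᵏ⁺¹) (m∣m*n (3 ^ k)))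
    where
    3n≡2n+n : ∀ n → 3 * n ≡ 2 * n + n
    3n≡2n+n n = solve (n ∷ [])

  3<3^⇒9≤3^ : ∀ k → 3 < 3 ^ k → 9 ≤ 3 ^ k
  3<3^⇒9≤3^ zero (s≤s ())
  3<3^⇒9≤3^ (suc zero) (s≤s (s≤s (s≤s ())))
  3<3^⇒9≤3^ (suc (suc k)) _ =
    subst (9 ≤_) (*-assoc 3 3 (3 ^ k)) (m≤m*n 9 (3 ^ k) {{>-nonZero (m^n>0 3 k)}})

module IntegerAlgebra where
  open import Data.Integer using (_+_; _*_; _-_; -_; _⊖_; 1ℤ)
  open import Data.Integer.Properties using (pos-+; pos-*; +-identityˡ; m-n≡m⊖n)
  open import Data.Integer.DivMod using (_%ℕ_; _/ℕ_; n%ℕd<d; a≡a%ℕn+[a/ℕn]*n)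
  open import Data.Integer.Divisibility.Signed
  open import Data.Integer.Tactic.RingSolver using (solve)
  open import Data.Nat.Coprimality using (Coprime; coprime-Bézout)
  open import Data.Nat.GCD using (module Bézout)
  open import Data.List using (_∷_; [])
  open import Relation.Nullary using (contradiction)
  open ≡-Reasoning

  pos-lin : ∀ u v w → + (u ℕ.+ v ℕ.* w) ≡ + u + + v * + w
  pos-lin u v w = trans (pos-+ u (v ℕ.* w)) (cong (λ z → + u + z) (pos-* v w))

  -- Opaque because unfolding these witnesses during unification is prohibitively expensive.
  opaque
    inverse-mod : ∀ {a f} → Coprime a f → Σ ℤ λ ι → + f ∣ + a * ι - 1ℤ
    inverse-mod {a} {f} a⊥f with coprime-Bézout a⊥f
    ... | Bézout.+- x y eq =
      + x , divides (+ y) (inverse {+ a} {+ x} {+ y} {+ f} (pos-lin 1 y f) (trans (cong +_ eq) (pos-* x a)))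
      where
      inverse : ∀ {A X Y F E} → E ≡ 1ℤ + Y * F → E ≡ X * A → A * X - 1ℤ ≡ Y * F
      inverse {A} {X} {Y} {F} refl e = begin
        A * X - 1ℤ          ≡⟨ solve (A ∷ X ∷ []) ⟩
        X * A - 1ℤ          ≡⟨ cong (λ z → z - 1ℤ) (sym e) ⟩
        1ℤ + Y * F - 1ℤ     ≡⟨ solve (Y ∷ F ∷ []) ⟩
        Y * F               ∎
    ... | Bézout.-+ x y eq =
      - + x , divides (- + y) (inverse {+ a} {+ x} {+ y} {+ f} (pos-lin 1 x a) (trans (cong +_ eq) (pos-* y f)))
      where
      inverse : ∀ {A X Y F E} → E ≡ 1ℤ + X * A → E ≡ Y * F → A * (- X) - 1ℤ ≡ (- Y) * F
      inverse {A} {X} {Y} {F} refl e = begin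
        A * (- X) - 1ℤ      ≡⟨ solve (A ∷ X ∷ []) ⟩
        - (1ℤ + X * A)      ≡⟨ cong -_ e ⟩
        - (Y * F)           ≡⟨ solve (Y ∷ F ∷ []) ⟩
        (- Y) * F           ∎

    solve-linear : ∀ {a f} .{{_ : ℕ.NonZero f}} → Coprime a f → ∀ B →
                   Σ ℕ λ y → y < f × + f ∣ + a * + y + B
    solve-linear {a} {f} a⊥f B with inverse-mod a⊥f
    ... | ι , f∣aι-1 = Z %ℕ f , n%ℕd<d Z f ,
          subst (+ f ∣_) (sym (reduce {+ a} {+ (Z %ℕ f)} {Z /ℕ f} {+ f} (a≡a%ℕn+[a/ℕn]*n Z f)))
            (∣m∣n⇒∣m-n (∣m⇒∣-m (∣m⇒∣m*n B f∣aι-1)) (∣n⇒∣m*n (+ a * (Z /ℕ f)) ∣-refl))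
      where
      Z : ℤ
      Z = - B * ι
      reduce : ∀ {A Y Q F} → - B * ι ≡ Y + Q * F → A * Y + B ≡ - ((A * ι - 1ℤ) * B) - A * Q * F
      reduce {A} {Y} {Q} {F} e = begin
        A * Y + B                          ≡⟨ solve (A ∷ Y ∷ Q ∷ F ∷ B ∷ []) ⟩
        A * (Y + Q * F) - A * Q * F + B    ≡⟨ cong (λ z → A * z - A * Q * F + B) (sym e) ⟩
        A * (- B * ι) - A * Q * F + B      ≡⟨ solve (A ∷ B ∷ ι ∷ Q ∷ F ∷ []) ⟩
        - ((A * ι - 1ℤ) * B) - A * Q * F   ∎

  solve-linear-ℕ : ∀ {a f} .{{_ : ℕ.NonZero f}} → Coprime a f → ∀ B →
                   Σ ℕ λ y → y < f × f ∣ℕ a ℕ.* y ℕ.+ B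
  solve-linear-ℕ {a} {f} a⊥f B with solve-linear {a} {f} a⊥f (+ B)
  ... | y , y<f , f∣ay+B = y , y<f , ∣⇒∣ᵤ {+ f} {+ (a ℕ.* y ℕ.+ B)} (subst (+ f ∣_) (sym cast) f∣ay+B)
    where
    cast : + (a ℕ.* y ℕ.+ B) ≡ + a * + y + + B
    cast = trans (pos-+ (a ℕ.* y) B) (cong (λ z → z + + B) (pos-* a y))

  *-pres-∣ : ∀ {i j m n} → i ∣ m → j ∣ n → i * j ∣ m * n
  *-pres-∣ {i} {j} (divides p refl) (divides q refl) = divides (p * q) (solve (p ∷ i ∷ q ∷ j ∷ []))

  slope : ℤ → ℕ → ℤ
  slope b s = + 3 * + s + b

  qt-increment : ∀ b c x t → qt b c (x ℕ.+ t) - qt b c x ≡ c * + t * slope b (x ℕ.+ x ℕ.+ t)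
  qt-increment b c x t = begin
    qt b c (x ℕ.+ t) - qt b c x                ≡⟨ cong (λ z → q z - q (+ x)) (pos-+ x t) ⟩
    q (+ x + + t) - q (+ x)                     ≡⟨ increment (+ x) (+ t) ⟩
    c * + t * (+ 3 * (+ x + + x + + t) + b)     ≡⟨ cong (λ z → c * + t * (+ 3 * z + b)) (sym 2x+t) ⟩
    c * + t * slope b (x ℕ.+ x ℕ.+ t)           ∎
    where
    q : ℤ → ℤ
    q X = + 3 * c * X * X + b * c * X
    increment : ∀ X T → (+ 3 * c * (X + T) * (X + T) + b * c * (X + T)) - (+ 3 * c * X * X + b * c * X)
                        ≡ c * T * (+ 3 * (X + X + T) + b)
    increment X T = solve (X ∷ T ∷ b ∷ c ∷ [])
    2x+t : + (x ℕ.+ x ℕ.+ t) ≡ + x + + x + + t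
    2x+t = trans (pos-+ (x ℕ.+ x) t) (cong (λ z → z + + t) (pos-+ x x))

  slope-+ : ∀ b L y → slope b (L ℕ.+ y) ≡ + 3 * + y + slope b L
  slope-+ b L y = begin
    + 3 * + (L ℕ.+ y) + b         ≡⟨ cong (λ z → + 3 * z + b) (pos-+ L y) ⟩
    + 3 * (+ L + + y) + b         ≡⟨ shift (+ L) (+ y) ⟩
    + 3 * + y + (+ 3 * + L + b)   ∎
    where
    shift : ∀ X Y → + 3 * (X + Y) + b ≡ + 3 * Y + (+ 3 * X + b)
    shift X Y = solve (X ∷ Y ∷ b ∷ [])

  slope-2x+t : ∀ b x t → slope b (x ℕ.+ x ℕ.+ t) ≡ + 6 * + x + slope b t
  slope-2x+t b x t = begin
    slope b (x ℕ.+ x ℕ.+ t)               ≡⟨ slope-+ b (x ℕ.+ x) t ⟩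
    + 3 * + t + slope b (x ℕ.+ x)         ≡⟨ cong (λ z → + 3 * + t + (+ 3 * z + b)) (pos-+ x x) ⟩
    + 3 * + t + (+ 3 * (+ x + + x) + b)   ≡⟨ double (+ x) (+ t) ⟩
    + 6 * + x + slope b t                 ∎
    where
    double : ∀ X T → + 3 * T + (+ 3 * (X + X) + b) ≡ + 6 * X + (+ 3 * T + b)
    double X T = solve (X ∷ T ∷ b ∷ [])

  slope-+ℕ : ∀ n s → slope (+ n) s ≡ + (3 ℕ.* s ℕ.+ n)
  slope-+ℕ n s = sym (trans (pos-+ (3 ℕ.* s) n) (cong (λ z → z + + n) (pos-* 3 s)))

  slope--[1+] : ∀ a s → slope -[1+ a ] s ≡ 3 ℕ.* s ⊖ ℕ.suc a
  slope--[1+] a s = trans (cong (λ z → z + -[1+ a ]) (sym (pos-* 3 s))) (m-n≡m⊖n (3 ℕ.* s) (ℕ.suc a))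

  2∣slope⇒2∣b : ∀ b h → + 2 ∣ slope b (h ℕ.+ h) → + 2 ∣ b
  2∣slope⇒2∣b b h 2∣slope = ∣m+n∣m⇒∣n (subst (+ 2 ∣_) even 2∣slope) (∣m⇒∣m*n (+ 3 * + h) ∣-refl)
    where
    double : ∀ H → + 3 * (H + H) + b ≡ + 2 * (+ 3 * H) + b
    double H = solve (H ∷ b ∷ [])
    even : slope b (h ℕ.+ h) ≡ + 2 * (+ 3 * + h) + b
    even = trans (cong (λ z → + 3 * z + b) (pos-+ h h)) (double (+ h))

  2∣slope-odd : ∀ {b} → ¬ (+ 2 ∣ b) → ∀ n → + 2 ∣ slope b (ℕ.suc (n ℕ.+ n))
  2∣slope-odd {b} 2∤b n with b %ℕ 2 | n%ℕd<d b 2 | a≡a%ℕn+[a/ℕn]*n b 2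
  ... | 0 | _ | b≡2q = contradiction (divides (b /ℕ 2) (trans b≡2q (+-identityˡ _))) 2∤b
  ... | 1 | _ | b≡1+2q = divides (+ 2 + + 3 * + n + b /ℕ 2) (begin
    + 3 * + ℕ.suc (n ℕ.+ n) + b
      ≡⟨ cong₂ (λ u v → + 3 * u + v) (pos-+ 1 (n ℕ.+ n)) b≡1+2q ⟩
    + 3 * (1ℤ + + (n ℕ.+ n)) + (1ℤ + b /ℕ 2 * + 2)
      ≡⟨ cong (λ u → + 3 * (1ℤ + u) + (1ℤ + b /ℕ 2 * + 2)) (pos-+ n n) ⟩
    + 3 * (1ℤ + (+ n + + n)) + (1ℤ + b /ℕ 2 * + 2)
      ≡⟨ halve (+ n) (b /ℕ 2) ⟩
    (+ 2 + + 3 * + n + b /ℕ 2) * + 2 ∎)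
    where
    halve : ∀ H Q → + 3 * (1ℤ + (H + H)) + (1ℤ + Q * + 2) ≡ (+ 2 + + 3 * H + Q) * + 2
    halve H Q = solve (H ∷ Q ∷ [])
  ... | ℕ.suc (ℕ.suc _) | ℕ.s≤s (ℕ.s≤s ()) | _

module LowRoots (N : ℕ) where
  open import Data.Nat using (zero; suc; _+_; _*_; _∸_; _%_; _/_; z≤n; s≤s; NonZero)
  open import Data.Nat.Properties
  open import Data.Nat.DivMod using (m%n<n; m≡m%n+[m/n]*n)
  open import Data.Nat.Divisibility using (divides; _∣0; ∣⇒≤; ∣m+n∣m⇒∣n; ∣m∣n⇒∣m+n; n∣m*n; m∣m*n)
  open import Data.Nat.Tactic.RingSolver using (solve)
  open import Data.Integer.Properties using (⊖-≥)
  open import Data.Integer.Divisibility.Signed using (∣ᵤ⇒∣; ∣⇒∣ᵤ) renaming (_∣_ to _∣ˢ_)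
  open import Data.List using (_∷_; [])
  open import Relation.Nullary using (contradiction)
  open Arithmetic
  open IntegerAlgebra using (solve-linear; solve-linear-ℕ; slope; slope-+ℕ; slope--[1+])

  -- With r = n mod m and s < m, the multiple 3s + r of m lies below 4m and is neither 0
  -- nor 3m (as 3 ∤ r), so 3s ≤ 2m < 6N.
  low-root⁺ : ∀ {n m} .{{_ : NonZero m}} → ¬ 3 ∣ℕ m → m < 3 * N → ¬ 3 ∣ℕ n % m →
              Σ ℕ λ s → 0 < s × s < N + N × + m ∣ˢ slope (+ n) s
  low-root⁺ {n} {m} 3∤m m<3N 3∤r with solve-linear-ℕ {3} {m} (prime∤⇒coprime prime[3] 3∤m) (n % m)
  ... | zero , _ , m∣r = contradiction (subst (3 ∣ℕ_) (sym r≡0) (3 ∣0)) 3∤r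
    where
    r≡0 : n % m ≡ 0
    r≡0 = n≤0⇒n≡0 (subst (n % m ≤_) (*-zeroˡ m)
            (multiple-below 0 m∣r (subst (n % m <_) (sym (+-identityʳ m)) (m%n<n n m))))
  ... | s@(suc _) , s<m , m∣X = s , s≤s z≤n , s<2N , subst (+ m ∣ˢ_) (sym (slope-+ℕ n s)) (∣ᵤ⇒∣ m∣3s+n)
    where
    X = 3 * s + n % m
    m∣3s+n : m ∣ℕ 3 * s + n
    m∣3s+n = subst (m ∣ℕ_)
               (trans (+-assoc (3 * s) (n % m) _) (cong (λ z → 3 * s + z) (sym (m≡m%n+[m/n]*n n m))))
               (∣m∣n⇒∣m+n m∣X (n∣m*n (n / m)))
    X≢3m : X ≢ 3 * m
    X≢3m X≡3m = 3∤r (∣m+n∣m⇒∣n (subst (3 ∣ℕ_) (sym X≡3m) (m∣m*n m)) (m∣m*n s))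
    X<4m : X < 4 * m
    X<4m = begin-strict
      3 * s + n % m   <⟨ +-mono-< (*-monoʳ-< 3 s<m) (m%n<n n m) ⟩
      3 * m + m       ≡⟨ solve (m ∷ []) ⟩
      4 * m           ∎
      where open ≤-Reasoning
    s<2N : s < N + N
    s<2N = *-cancelˡ-< 3 s (N + N) (begin-strict
      3 * s         ≤⟨ m≤m+n (3 * s) (n % m) ⟩
      X             ≤⟨ multiple-below 2 m∣X (≤∧≢⇒< (multiple-below 3 m∣X X<4m) X≢3m) ⟩
      2 * m         <⟨ *-monoʳ-< 2 m<3N ⟩
      2 * (3 * N)   ≡⟨ solve (N ∷ []) ⟩
      3 * (N + N)   ∎)
      where open ≤-Reasoning

  -- Here 3s − (1 + a) is a multiple of m below 3m, hence at most 2m; for b = −2 this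
  -- still gives s < 2N because m ≠ 3N − 1, which is even as N is odd.
  low-root⁻ : ∀ {a m} .{{_ : NonZero m}} → a ≤ 1 → ¬ 2 ∣ℕ N → ¬ 3 ∣ℕ m → N + N < m → m < 3 * N →
              (a ≡ 1 → ¬ 2 ∣ℕ m) → Σ ℕ λ s → 0 < s × s < N + N × + m ∣ˢ slope -[1+ a ] s
  low-root⁻ {a} {m} a≤1 2∤N 3∤m 2N<m m<3N 2∤m
    with solve-linear {3} {m} (prime∤⇒coprime prime[3] 3∤m) -[1+ a ]
  ... | zero , _ , m∣b = contradiction (∣⇒≤ (∣⇒∣ᵤ m∣b)) (<⇒≱ (≤-<-trans (s≤s a≤1) (≤-<-trans 2≤2N 2N<m)))
    where
    2≤2N : 2 ≤ N + N
    2≤2N = +-mono-≤ (∤⇒0< 2∤N) (∤⇒0< 2∤N)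
  ... | s@(suc _) , s<m , m∣slope = s , s≤s z≤n , s<2N , m∣slope
    where
    1+a≤3s : suc a ≤ 3 * s
    1+a≤3s = ≤-trans (s≤s (≤-trans a≤1 (s≤s z≤n))) (m≤m*n 3 s)
    X = 3 * s ∸ suc a
    m∣X : m ∣ℕ X
    m∣X = ∣⇒∣ᵤ (subst (+ m ∣ˢ_) (trans (slope--[1+] a s) (⊖-≥ 1+a≤3s)) m∣slope)
    X+1+a≡3s : X + suc a ≡ 3 * s
    X+1+a≡3s = m∸n+n≡m 1+a≤3s
    X≤2m : X ≤ 2 * m
    X≤2m = multiple-below 2 m∣X (begin-strict
      X              <⟨ m<m+n X (s≤s z≤n) ⟩
      X + suc a      ≡⟨ X+1+a≡3s ⟩
      3 * s          ≤⟨ *-monoʳ-≤ 3 (<⇒≤ s<m) ⟩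
      3 * m          ∎)
      where open ≤-Reasoning
    bound : ∀ {a} → a ≤ 1 → (a ≡ 1 → ¬ 2 ∣ℕ m) → 2 * m + suc a < 3 * (N + N)
    bound z≤n _ = begin-strict
      2 * m + 1       <⟨ ≤-reflexive (solve (m ∷ [])) ⟩
      2 * suc m       ≤⟨ *-monoʳ-≤ 2 m<3N ⟩
      2 * (3 * N)     ≡⟨ solve (N ∷ []) ⟩
      3 * (N + N)     ∎
      where open ≤-Reasoning
    bound (s≤s z≤n) 2∤m = begin-strict
      2 * m + 2               <⟨ n<1+n _ ⟩
      suc (2 * m + 2)         ≤⟨ n≤1+n _ ⟩
      suc (suc (2 * m + 2))   ≡⟨ solve (m ∷ []) ⟩
      2 * suc (suc m)         ≤⟨ *-monoʳ-≤ 2 (≤∧≢⇒< m<3N (1+m≢3N (parity N))) ⟩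
      2 * (3 * N)             ≡⟨ solve (N ∷ []) ⟩
      3 * (N + N)             ∎
      where
      open ≤-Reasoning
      1+m≢3N : Parity N → suc m ≢ 3 * N
      1+m≢3N (even h) _ = 2∤N (2∣h+h h)
      1+m≢3N (odd n) 1+m≡3N = 2∤m refl (divides (1 + 3 * n) (suc-injective (trans 1+m≡3N (solve (n ∷ [])))))
    s<2N : s < N + N
    s<2N = *-cancelˡ-< 3 s (N + N) (begin-strict
      3 * s           ≡⟨ sym X+1+a≡3s ⟩
      X + suc a       ≤⟨ +-monoˡ-≤ (suc a) X≤2m ⟩
      2 * m + suc a   <⟨ bound a≤1 2∤m ⟩
      3 * (N + N)     ∎)
      where open ≤-Reasoning

  low-root : ∀ {b m} .{{_ : NonZero m}} → -[1+ 1 ] ℤ.≤ b → b ≢ + 0 → ¬ 2 ∣ℕ N → ¬ 3 ∣ℕ m →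
             N + N < m → m < 3 * N → (∀ {n} → b ≡ + n → ¬ 3 ∣ℕ n % m) → (b ≡ -[1+ 1 ] → ¬ 2 ∣ℕ m) →
             Σ ℕ λ s → 0 < s × s < N + N × + m ∣ˢ slope b s
  low-root {+ zero} _ b≢0 = contradiction refl b≢0
  low-root {+ suc n} _ _ _ 3∤m _ m<3N 3∤r _ = low-root⁺ 3∤m m<3N (3∤r refl)
  low-root { -[1+ 0 ]} _ _ 2∤N 3∤m 2N<m m<3N _ _ = low-root⁻ z≤n 2∤N 3∤m 2N<m m<3N λ ()
  low-root { -[1+ 1 ]} _ _ 2∤N 3∤m 2N<m m<3N _ 2∤m = low-root⁻ (s≤s z≤n) 2∤N 3∤m 2N<m m<3N (λ _ → 2∤m refl)
  low-root { -[1+ suc (suc _) ]} (ℤ.-≤- (s≤s ()))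

module Collisions (b c : ℤ) (N : ℕ) where
  open import Data.Nat using (suc; _+_; _*_; z≤n; s≤s)
  open import Data.Nat.Properties
  open import Data.Nat.Divisibility using (divides; ∣-refl; _∣?_; 1∣_)
  open import Data.Nat.Tactic.RingSolver using (solve)
  open import Data.Integer.Divisibility.Signed
    using (∣ᵤ⇒∣; ∣⇒∣ᵤ; ∣-trans; ∣n⇒∣m*n; ∣m⇒∣m*n; ∣m+n∣m⇒∣n) renaming (_∣_ to _∣ˢ_)
  open import Data.List using (_∷_; [])
  open import Function using (_∘_)
  open import Relation.Nullary using (yes; no; contradiction)
  open Arithmetic
  open IntegerAlgebra
    using (solve-linear; slope; slope-+; slope-2x+t; qt-increment; *-pres-∣; 2∣slope⇒2∣b; 2∣slope-odd)

  Collision : ℕ → Set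
  Collision m = Σ ℕ λ i → Σ ℕ λ j → i < j × j ≤ N × + m ∣ℤ (qt b c j ℤ.- qt b c i)

  collision : ∀ {u v} x t → 0 < t → x + t ≤ N → + u ∣ˢ c ℤ.* + t → + v ∣ˢ slope b (x + x + t) →
              Collision (u * v)
  collision {u} {v} x t 0<t x+t≤N u∣ct v∣slope = x , x + t , m<m+n x 0<t , x+t≤N ,
    ∣⇒∣ᵤ (subst₂ _∣ˢ_ (sym (ℤP.pos-* u v)) (sym (qt-increment b c x t)) (*-pres-∣ u∣ct v∣slope))

  1∣ˢ : ∀ z → + 1 ∣ˢ z
  1∣ˢ z = ∣ᵤ⇒∣ (1∣ ∣ z ∣)

  collision-small : ∀ {m} → 0 < m → m ≤ N → Collision m
  collision-small {m} 0<m m≤N = subst Collision (*-identityʳ m)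
    (collision 0 m 0<m m≤N (∣n⇒∣m*n c (∣ᵤ⇒∣ ∣-refl)) (1∣ˢ _))

  collision-∣c : ∀ {m} → 0 < N → + m ∣ˢ c → Collision m
  collision-∣c {m} 0<N m∣c = subst Collision (*-identityʳ m)
    (collision 0 1 (s≤s z≤n) 0<N (∣m⇒∣m*n (+ 1) m∣c) (1∣ˢ _))

  collision-via-slope : ∀ {m s} → 0 < s → s < N + N → + m ∣ˢ slope b s → Collision m
  collision-via-slope {m} {s} 0<s s<2N m∣slope
    with split-2x+t {N} {s} 0 (s≤s 0<s) (subst (_≤ suc (N + N)) (+-comm 2 s) (s≤s s<2N))
  ... | x , t , _ , 0<t , x+t≤N , refl =
    subst Collision (*-identityˡ m) (collision x t 0<t x+t≤N (1∣ˢ _) m∣slope)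

  Chord : ℕ → ℕ → Set
  Chord d f = Σ ℕ λ x → Σ ℕ λ t → 0 < t × x + t ≤ N × d ∣ℕ t × + f ∣ˢ slope b (x + x + t)

  -- The root s is taken in the window [2d − 1, 2d − 1 + f), whose left end is suc (z + z) + (z + z).
  chord-in-window : ∀ {d f} → ¬ 2 ∣ℕ d → ¬ 3 ∣ℕ f → f + 4 * d ≤ 2 * N + 3 → Chord d f
  chord-in-window {d} {f} 2∤d 3∤f bound with parity d
  ... | even h = contradiction (2∣h+h h) 2∤d
  ... | odd z
    with solve-linear {3} {f} {{∤⇒nonZero 3∤f}} (prime∤⇒coprime prime[3] 3∤f) (slope b (suc (z + z) + (z + z)))
  ...   | y , y<f , f∣slope with split-2x+t {N} {suc (z + z) + (z + z) + y} z (lo y) (hi y y<f)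
    where
    lo : ∀ y → suc (z + z) + suc (z + z) ≤ suc (suc (z + z) + (z + z) + y)
    lo y = begin
      suc (z + z) + suc (z + z)          ≡⟨ solve (z ∷ []) ⟩
      suc (suc (z + z) + (z + z))        ≤⟨ s≤s (m≤m+n _ y) ⟩
      suc (suc (z + z) + (z + z) + y)    ∎
      where open ≤-Reasoning
    hi : ∀ y → y < f → suc (z + z) + (z + z) + y + (suc (z + z) + suc (z + z)) ≤ suc (N + N)
    hi y y<f = ≤-pred (≤-pred (begin
      suc (suc (suc (z + z) + (z + z) + y + (suc (z + z) + suc (z + z))))
        ≡⟨ solve (z ∷ y ∷ []) ⟩
      suc (suc y + (suc (z + z) + (z + z) + (suc (z + z) + suc (z + z))))
        ≤⟨ s≤s (+-monoˡ-≤ _ y<f) ⟩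
      suc (f + (suc (z + z) + (z + z) + (suc (z + z) + suc (z + z))))
        ≡⟨ solve (z ∷ f ∷ []) ⟩
      f + 4 * suc (z + z)
        ≤⟨ bound ⟩
      2 * N + 3
        ≡⟨ solve (N ∷ []) ⟩
      suc (suc (suc (N + N))) ∎))
      where open ≤-Reasoning
  ...     | x , t , d∣t , 0<t , x+t≤N , 2x+t≡s = x , t , 0<t , x+t≤N , d∣t ,
              subst (λ s → + f ∣ˢ slope b s) (sym 2x+t≡s)
                (subst (+ f ∣ˢ_) (sym (slope-+ b (suc (z + z) + (z + z)) y)) f∣slope)

  collision-window : ∀ {d f} → ¬ 2 ∣ℕ d → ¬ 3 ∣ℕ f → f + 4 * d ≤ 2 * N + 3 → Collision (d * f)
  collision-window 2∤d 3∤f bound with chord-in-window 2∤d 3∤f bound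
  ... | x , t , 0<t , x+t≤N , d∣t , f∣slope = collision x t 0<t x+t≤N (∣n⇒∣m*n c (∣ᵤ⇒∣ d∣t)) f∣slope

  chord-below-2N : ∀ {f} → ¬ 3 ∣ℕ f → f < N + N → Chord 1 f
  chord-below-2N {f} 3∤f f<2N = chord-in-window (2∤odd 0) 3∤f (begin
    f + 4 * 1    ≡⟨ solve (f ∷ []) ⟩
    suc f + 3    ≤⟨ +-monoˡ-≤ 3 f<2N ⟩
    N + N + 3    ≡⟨ solve (N ∷ []) ⟩
    2 * N + 3    ∎)
    where open ≤-Reasoning

  collision-below-2N : ∀ {f} → ¬ 3 ∣ℕ f → f < N + N → Collision f
  collision-below-2N {f} 3∤f f<2N with chord-below-2N 3∤f f<2N
  ... | x , t , 0<t , x+t≤N , _ , f∣slope =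
    subst Collision (*-identityˡ f) (collision x t 0<t x+t≤N (1∣ˢ _) f∣slope)

  collision-2∣c : ∀ {f} → + 2 ∣ˢ c → ¬ 3 ∣ℕ f → f < N + N → Collision (2 * f)
  collision-2∣c 2∣c 3∤f f<2N with chord-below-2N 3∤f f<2N
  ... | x , t , 0<t , x+t≤N , _ , f∣slope = collision x t 0<t x+t≤N (∣m⇒∣m*n (+ t) 2∣c) f∣slope

  collision-cofactor : ∀ {d t} → ¬ 2 ∣ℕ d → ¬ 3 ∣ℕ d → 0 < t → d + t ≤ suc N → Collision (t * d)
  collision-cofactor {d} {t} 2∤d 3∤d 0<t d+t≤1+N
    with solve-linear {6} {d} {{∤⇒nonZero 2∤d}} (coprime-6 2∤d 3∤d) (slope b t)
  ... | x , x<d , d∣6x+slope = collision x t 0<t (≤-pred (≤-trans (+-monoˡ-≤ t x<d) d+t≤1+N))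
          (∣n⇒∣m*n c (∣ᵤ⇒∣ ∣-refl)) (subst (+ d ∣ˢ_) (sym (slope-2x+t b x t)) d∣6x+slope)

  collision-2N : ¬ 2 ∣ℕ N → (+ 2 ∣ˢ b → + 2 ∣ˢ c) → Collision (2 * N)
  collision-2N 2∤N 2∣b⇒2∣c with parity N
  ... | even h = contradiction (2∣h+h h) 2∤N
  ... | odd n with 2 ∣? ∣ b ∣
  ...   | yes 2∣b = subst Collision (*-identityʳ (2 * N)) (collision 0 N (s≤s z≤n) ≤-refl 2N∣cN (1∣ˢ _))
    where
    2N∣cN : + (2 * N) ∣ˢ c ℤ.* + N
    2N∣cN = subst (_∣ˢ c ℤ.* + N) (sym (ℤP.pos-* 2 N))
              (*-pres-∣ (2∣b⇒2∣c (∣ᵤ⇒∣ {+ 2} {b} 2∣b)) (∣ᵤ⇒∣ {+ N} {+ N} ∣-refl))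
  ...   | no 2∤b = subst Collision (*-comm N 2)
            (collision 0 N (s≤s z≤n) ≤-refl (∣n⇒∣m*n c (∣ᵤ⇒∣ {+ N} {+ N} ∣-refl))
              (2∣slope-odd {b} (2∤b ∘ ∣⇒∣ᵤ) n))

  -- A root s of 3s + b ≡ 0 (mod 2r) is odd; if it is not below 2N, then s − r is an even
  -- root modulo r and the length t = 2 supplies the factor 2.
  collision-twice-odd : ∀ {r} → ¬ (+ 2 ∣ˢ b) → ¬ 2 ∣ℕ r → ¬ 3 ∣ℕ 2 * r → 2 * r < 3 * N → Collision (2 * r)
  collision-twice-odd {r} 2∤b 2∤r 3∤2r 2r<3N
    with solve-linear {3} {2 * r} {{∤⇒nonZero 3∤2r}} (prime∤⇒coprime prime[3] 3∤2r) b
  ... | s , s<2r , 2r∣slope with parity s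
  ...   | even h = contradiction (2∣slope⇒2∣b b h (∣-trans (∣ᵤ⇒∣ (divides r (*-comm 2 r))) 2r∣slope)) 2∤b
  ...   | odd h with suc (h + h) <? N + N
  ...     | yes s<2N = collision-via-slope (s≤s z≤n) s<2N 2r∣slope
  ...     | no s≮2N with parity r
  ...       | even q = contradiction (2∣h+h q) 2∤r
  ...       | odd z with m≤n⇒∃[o]m+o≡n {suc z} {h} (half-≤ z<h)
    where
    z<h : suc z + suc z ≤ suc (h + h)
    z<h = ≤-trans (≤-reflexive (cong suc (+-suc z z)))
            (<-≤-trans (2m<3n⇒m<2n {suc (z + z)} {N} 2r<3N) (≮⇒≥ s≮2N))
  ...         | w , refl = collision w 2 (s≤s z≤n) w+2≤N (∣n⇒∣m*n c (∣ᵤ⇒∣ ∣-refl)) r∣slope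
    where
    shift : slope b (suc (suc z + w + (suc z + w))) ≡ + 3 ℤ.* + r ℤ.+ slope b (w + w + 2)
    shift = trans (cong (slope b) s≡) (slope-+ b (w + w + 2) (suc (z + z)))
      where
      s≡ : suc (suc z + w + (suc z + w)) ≡ w + w + 2 + suc (z + z)
      s≡ = solve (z ∷ w ∷ [])
    r∣slope : + r ∣ˢ slope b (w + w + 2)
    r∣slope = ∣m+n∣m⇒∣n (subst (+ r ∣ˢ_) shift (∣-trans (∣ᵤ⇒∣ (divides 2 refl)) 2r∣slope))
                (∣n⇒∣m*n (+ 3) (∣ᵤ⇒∣ {+ r} {+ r} ∣-refl))
    z<N : suc z ≤ N
    z<N = half-≤ (≤-trans (≤-reflexive (cong suc (+-suc z z)))
            (≤-trans (2m<3n⇒m<2n {suc (z + z)} {N} 2r<3N) (n≤1+n _)))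
    w+2≤z+1 : suc (suc w) + suc (suc w) ≤ suc z + suc z
    w+2≤z+1 = +-cancelʳ-≤ (z + z) _ _ (begin
      suc (suc w) + suc (suc w) + (z + z)    ≡⟨ solve (z ∷ w ∷ []) ⟩
      suc (suc (suc z + w + (suc z + w)))    ≤⟨ s<2r ⟩
      2 * suc (z + z)                        ≡⟨ solve (z ∷ []) ⟩
      suc z + suc z + (z + z)                ∎)
      where open ≤-Reasoning
    w+2≤N : w + 2 ≤ N
    w+2≤N = ≤-trans (≤-reflexive (+-comm w 2)) (≤-trans (half-≤ (≤-trans w+2≤z+1 (n≤1+n _))) z<N)

module Main (k : ℕ) (b c : ℤ) (b≢0 : ¬ (b ≡ + 0)) (-2≤b : -[1+ 1 ] ℤ.≤ b)
  (3∤bc : ¬ ((+ 3) ∣ℤ (b ℤ.* c)))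
  (b-even : (+ 2) ∣ℤ b → (+ 2) ∣ℤ c)
  (b-odd : ¬ ((+ 2) ∣ℤ b) →
    Σ ℕ (λ x → (2 ℕ.* 3 ^ k < 2 ^ x) × (2 ^ x < 3 ^ (k ℕ.+ 1)) ×
               (2 ^ x ≤ ∣ b ∣) × (3 ∣ℕ (b mod2^ x))) →
    (+ 2) ∣ℤ c)
  (primes : (p : ℕ) (pp : Prime p) → 2 ℕ.* 3 ^ k < p → p < 3 ^ (k ℕ.+ 1) →
    p ≤ ∣ b ∣ → 3 ∣ℕ modPrime b p pp → (+ p) ∣ℤ c) where
  open import Data.Nat
    using (zero; suc; _+_; _*_; _%_; z≤n; s≤s; NonZero; _≤?_; _<?_; _≟_; nonTrivial⇒n>1; n>1⇒nonTrivial)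
  open import Data.Nat.Properties
  open import Data.Nat.Divisibility
    using (divides; _∣?_; ∣-refl; ∣-trans; ∣m⇒∣m*n; ∣n⇒∣m*n; quotient; quotient>1; quotient-∣;
           m∣n⇒n≡quotient*m)
  open import Data.Nat.Divisibility.Core using (hasNonTrivialDivisor)
  open import Data.Nat.DivMod using (m<n⇒m%n≡m)
  open import Data.Nat.Primality using (Composite; prime?; ¬prime⇒composite; prime⇒nonZero)
  open import Data.Integer.Divisibility.Signed using (∣ᵤ⇒∣; ∣⇒∣ᵤ)
  open import Function using (_∘_)
  open import Relation.Nullary using (yes; no; contradiction)
  open import Relation.Nullary.Decidable using (_×-dec_)

  N : ℕ
  N = 3 ^ k

  open Arithmetic
  open Collisions b c N
  open LowRoots N

  2N≡N+N : 2 * N ≡ N + N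
  2N≡N+N = cong (λ z → N + z) (+-identityʳ N)

  0<N : 0 < N
  0<N = m^n>0 3 k

  above-2·3ᵏ : ∀ {m} → N + N < m → 2 ℕ.* 3 ^ k < m
  above-2·3ᵏ {m} = subst (λ z → z < m) (sym 2N≡N+N)

  below-3ᵏ⁺¹ : ∀ {m} → m < 3 * N → m < 3 ^ (k ℕ.+ 1)
  below-3ᵏ⁺¹ {m} = subst (λ z → m < z) (cong (3 ^_) (+-comm 1 k))

  3∤b : ∀ {n} → b ≡ + n → ¬ 3 ∣ℕ n
  3∤b {n} refl 3∣n = 3∤bc (subst (3 ∣ℕ_) (sym (ℤP.abs-* (+ n) c)) (∣m⇒∣m*n ∣ c ∣ 3∣n))

  3∤residue : ∀ {m} .{{_ : NonZero m}} → ¬ (m ≤ ∣ b ∣ × 3 ∣ℕ b ℤ.%ℕ m) →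
              ∀ {n} → b ≡ + n → ¬ 3 ∣ℕ n % m
  3∤residue {m} ¬both {n} refl 3∣r with m ≤? n
  ... | yes m≤n = ¬both (m≤n , 3∣r)
  ... | no m≰n = 3∤b refl (subst (3 ∣ℕ_) (m<n⇒m%n≡m (≰⇒> m≰n)) 3∣r)

  collision-from-low-root : ∀ {m} .{{_ : NonZero m}} → ¬ 3 ∣ℕ m → N + N < m → m < 3 * N →
                            ¬ (m ≤ ∣ b ∣ × 3 ∣ℕ b ℤ.%ℕ m) → (b ≡ -[1+ 1 ] → ¬ 2 ∣ℕ m) → Collision m
  collision-from-low-root 3∤m 2N<m m<3N ¬both b≡-2⇒2∤m
    with low-root -2≤b b≢0 (2∤3^ k) 3∤m 2N<m m<3N (3∤residue ¬both) b≡-2⇒2∤m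
  ... | s , 0<s , s<2N , m∣slope = collision-via-slope 0<s s<2N m∣slope

  collision-prime : ∀ {m} → Prime m → ¬ 2 ∣ℕ m → ¬ 3 ∣ℕ m → N + N < m → m < 3 * N → Collision m
  collision-prime {m} pp 2∤m 3∤m 2N<m m<3N with (m ≤? ∣ b ∣) ×-dec (3 ∣? modPrime b m pp)
  ... | yes (m≤b , 3∣r) = collision-∣c 0<N (∣ᵤ⇒∣ (primes m pp (above-2·3ᵏ 2N<m) (below-3ᵏ⁺¹ m<3N) m≤b 3∣r))
  ... | no ¬both = collision-from-low-root {{prime⇒nonZero pp}} 3∤m 2N<m m<3N ¬both (λ _ → 2∤m)

  sum≤-of-product-3^ : ∀ {d e} → 4 ≤ d → 4 ≤ e → d * e < 3 * N → d + e ≤ suc N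
  sum≤-of-product-3^ 4≤d 4≤e de<3N = sum≤-of-product 4≤d 4≤e (≤-trans (n≤1+n 8) (3<3^⇒9≤3^ k 3<N)) de<3N
    where
    3<N : 3 < N
    3<N = ≰⇒> λ N≤3 → <⇒≱ (≤-<-trans (*-mono-≤ 4≤d 4≤e) de<3N) (≤-trans (*-monoʳ-≤ 3 N≤3) (m≤m+n 9 7))

  collision-composite : ∀ {m} → Composite m → ¬ 2 ∣ℕ m → ¬ 3 ∣ℕ m → m < 3 * N → Collision m
  collision-composite {m} (hasNonTrivialDivisor {d} {{_}} d<m d∣m) 2∤m 3∤m m<3N =
    subst Collision (sym (m∣n⇒n≡quotient*m d∣m))
      (collision-cofactor 2∤d 3∤d (<-trans (s≤s z≤n) 1<e)
        (sum≤-of-product-3^ (4≤-coprime-6 (nonTrivial⇒n>1 d) 2∤d 3∤d) (4≤-coprime-6 1<e 2∤e 3∤e) de<3N))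
    where
    e = quotient d∣m
    1<e : 1 < e
    1<e = quotient>1 d∣m d<m
    2∤d = λ 2∣d → 2∤m (∣-trans 2∣d d∣m)
    3∤d = λ 3∣d → 3∤m (∣-trans 3∣d d∣m)
    2∤e = λ 2∣e → 2∤m (∣-trans 2∣e (quotient-∣ d∣m))
    3∤e = λ 3∣e → 3∤m (∣-trans 3∣e (quotient-∣ d∣m))
    de<3N : d * e < 3 * N
    de<3N = subst (_< 3 * N) (trans (m∣n⇒n≡quotient*m d∣m) (*-comm e d)) m<3N

  collision-power-of-2 : ∀ a → ¬ 2 ∣ℕ ∣ b ∣ → ¬ 3 ∣ℕ 2 ^ suc a → N + N < 2 ^ suc a → 2 ^ suc a < 3 * N →
                         Collision (2 ^ suc a)
  collision-power-of-2 a 2∤b 3∤m 2N<m m<3N with (2 ^ suc a ≤? ∣ b ∣) ×-dec (3 ∣? b mod2^ suc a)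
  ... | yes (m≤b , 3∣r) =
    collision-2∣c {2 ^ a} (∣ᵤ⇒∣ (b-odd 2∤b (suc a , above-2·3ᵏ 2N<m , below-3ᵏ⁺¹ m<3N , m≤b , 3∣r)))
      (3∤m ∘ ∣n⇒∣m*n 2) (2m<3n⇒m<2n {2 ^ a} {N} m<3N)
  ... | no ¬both = collision-from-low-root {{m^n≢0 2 (suc a)}} 3∤m 2N<m m<3N ¬both
                     (λ b≡-2 _ → 2∤b (subst (λ z → 2 ∣ℕ ∣ z ∣) (sym b≡-2) ∣-refl))

  collision-2ᵃ·r : ∀ a r → ¬ 2 ∣ℕ ∣ b ∣ → ¬ 2 ∣ℕ r → 2 ∣ℕ 2 ^ a * r → ¬ 3 ∣ℕ 2 ^ a * r →
                   N + N < 2 ^ a * r → 2 ^ a * r < 3 * N → Collision (2 ^ a * r)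
  collision-2ᵃ·r zero r _ 2∤r 2∣m _ _ _ = contradiction (subst (2 ∣ℕ_) (+-identityʳ r) 2∣m) 2∤r
  collision-2ᵃ·r (suc a) r 2∤b 2∤r _ 3∤m 2N<m m<3N with parity r
  ... | even q = contradiction (2∣h+h q) 2∤r
  ... | odd zero = subst Collision (sym m≡2ᵃ)
          (collision-power-of-2 a 2∤b (3∤m ∘ subst (3 ∣ℕ_) (sym m≡2ᵃ)) (subst (N + N <_) m≡2ᵃ 2N<m)
            (subst (_< 3 * N) m≡2ᵃ m<3N))
    where
    m≡2ᵃ : 2 ^ suc a * 1 ≡ 2 ^ suc a
    m≡2ᵃ = *-identityʳ (2 ^ suc a)
  collision-2ᵃ·r 1 _ 2∤b 2∤r _ 3∤m _ m<3N | odd (suc z) = collision-twice-odd (2∤b ∘ ∣⇒∣ᵤ) 2∤r 3∤m m<3N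
  collision-2ᵃ·r (suc (suc a)) r _ 2∤r _ 3∤m _ m<3N | odd (suc z) =
    collision-cofactor 2∤r 3∤r (m^n>0 2 (2 + a))
      (sum≤-of-product-3^ (4≤-coprime-6 (s≤s (s≤s z≤n)) 2∤r 3∤r) 4≤2ᵃ
        (subst (_< 3 * N) (*-comm (2 ^ (2 + a)) r) m<3N))
    where
    3∤r = 3∤m ∘ ∣n⇒∣m*n (2 ^ (2 + a))
    4≤2ᵃ : 4 ≤ 2 ^ (2 + a)
    4≤2ᵃ = *-monoʳ-≤ 2 (*-monoʳ-≤ 2 (m^n>0 2 a))

  collision-even : ∀ {m} → 2 ∣ℕ m → ¬ 3 ∣ℕ m → N + N < m → m < 3 * N → Collision m
  collision-even {m} 2∣m 3∤m 2N<m m<3N with 2 ∣? ∣ b ∣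
  ... | yes 2∣b with 2∣m
  ...   | divides f refl = subst Collision (*-comm 2 f)
            (collision-2∣c {f} (∣ᵤ⇒∣ (b-even 2∣b)) (3∤m ∘ ∣m⇒∣m*n 2)
              (2m<3n⇒m<2n {f} {N} (subst (_< 3 * N) (*-comm f 2) m<3N)))
  collision-even {m} 2∣m 3∤m 2N<m m<3N | no 2∤b with factor-out {2} (s≤s (s≤s z≤n)) m (≤-<-trans z≤n 2N<m)
  ... | a , r , refl , 2∤r = collision-2ᵃ·r a r 2∤b 2∤r 2∣m 3∤m 2N<m m<3N

  collision-above-2N : ∀ {m} → ¬ 3 ∣ℕ m → N + N < m → m < 3 * N → Collision m
  collision-above-2N {m} 3∤m 2N<m m<3N with parity m
  ... | even h = collision-even (2∣h+h h) 3∤m 2N<m m<3N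
  ... | odd z with prime? (suc (z + z))
  ...   | yes pp = collision-prime pp (2∤odd z) 3∤m 2N<m m<3N
  ...   | no ¬pp = collision-composite (¬prime⇒composite {{n>1⇒nonTrivial 1<m}} ¬pp) (2∤odd z) 3∤m m<3N
    where
    1<m : 1 < suc (z + z)
    1<m = <⇒≤ (≤-<-trans (+-mono-≤ 0<N 0<N) 2N<m)

  collision-3-adic : ∀ {m} → 0 < m → 3 ∣ℕ m → N < m → m < 3 * N → m ≢ 2 * N → Collision m
  collision-3-adic {m} 0<m 3∣m N<m m<3N m≢2N with factor-out {3} (s≤s (s≤s z≤n)) m 0<m
  ... | zero , m₁ , m≡m₁ , 3∤m₁ = contradiction (subst (3 ∣ℕ_) (trans m≡m₁ (*-identityˡ m₁)) 3∣m) 3∤m₁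
  ... | suc β , m₁ , m≡Xm₁ , 3∤m₁ with suc β <? k
  ...   | no β≮k = contradiction (between-N-and-3N⇒2N N∣m N<m m<3N) m≢2N
    where
    N∣m : N ∣ℕ m
    N∣m = ∣-trans (^-monoʳ-∣ 3 (≮⇒≥ β≮k)) (divides m₁ (trans m≡Xm₁ (*-comm _ m₁)))
  ...   | yes β<k with m≤n⇒∃[o]m+o≡n β<k
  ...     | γ , β+γ≡k = subst Collision (sym m≡Xm₁) (collision-window (2∤3^ (suc β)) 3∤m₁ bound)
    where
    X = 3 ^ suc β
    Y = 3 ^ suc γ
    N≡XY : N ≡ X * Y
    N≡XY = trans (cong (3 ^_) (trans (sym β+γ≡k) (sym (+-suc (suc β) γ)))) (^-distribˡ-+-* 3 (suc β) (suc γ))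
    m₁<3Y : m₁ < 3 * Y
    m₁<3Y = *-cancelˡ-< X m₁ (3 * Y) (begin-strict
      X * m₁          ≡⟨ sym m≡Xm₁ ⟩
      m               <⟨ m<3N ⟩
      3 * N           ≡⟨ cong (3 *_) N≡XY ⟩
      3 * (X * Y)     ≡⟨ sym (*-assoc 3 X Y) ⟩
      3 * X * Y       ≡⟨ cong (_* Y) (*-comm 3 X) ⟩
      X * 3 * Y       ≡⟨ *-assoc X 3 Y ⟩
      X * (3 * Y)     ∎)
      where open ≤-Reasoning
    bound : m₁ + 4 * X ≤ 2 * N + 3
    bound = subst (λ z → m₁ + 4 * X ≤ 2 * z + 3) (sym N≡XY)
      (3-adic-bound (*-monoʳ-≤ 3 (m^n>0 3 β)) (*-monoʳ-≤ 3 (m^n>0 3 γ)) m₁<3Y)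

  collision-below-3N : ∀ {m} → 0 < m → m < 3 * N → Collision m
  collision-below-3N {m} 0<m m<3N with m ≤? N
  ... | yes m≤N = collision-small 0<m m≤N
  ... | no m≰N with m ≟ 2 * N
  ...   | yes refl = collision-2N (2∤3^ k) (∣ᵤ⇒∣ ∘ b-even ∘ ∣⇒∣ᵤ)
  ...   | no m≢2N with 3 ∣? m
  ...     | yes 3∣m = collision-3-adic 0<m 3∣m (≰⇒> m≰N) m<3N m≢2N
  ...     | no 3∤m with m <? N + N
  ...       | yes m<2N = collision-below-2N 3∤m m<2N
  ...       | no m≮2N = collision-above-2N 3∤m 2N<m m<3N
    where
    2N<m : N + N < m
    2N<m = ≤∧≢⇒< (≮⇒≥ m≮2N) λ 2N≡m → m≢2N (trans (sym 2N≡m) (sym 2N≡N+N))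

lemma22 : (k : ℕ) (b c : ℤ) →
    ¬ (b ≡ + 0) → ¬ (c ≡ + 0) →
    -[1+ 1 ] ℤ.≤ b →
    ¬ ((+ 3) ∣ℤ (b ℤ.* c)) →
    ((+ 2) ∣ℤ b → (+ 2) ∣ℤ c) →
    (¬ ((+ 2) ∣ℤ b) →
      Σ ℕ (λ x → (2 ℕ.* 3 ^ k < 2 ^ x) × (2 ^ x < 3 ^ (k ℕ.+ 1)) ×
                 (2 ^ x ≤ ∣ b ∣) × (3 ∣ℕ (b mod2^ x))) →
      (+ 2) ∣ℤ c) →
    ((p : ℕ) (pp : Prime p) → 2 ℕ.* 3 ^ k < p → p < 3 ^ (k ℕ.+ 1) →
      p ≤ ∣ b ∣ → 3 ∣ℕ modPrime b p pp → (+ p) ∣ℤ c) →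
    (m : ℕ) → 0 < m → m < 3 ^ (k ℕ.+ 1) →
    Σ ℕ (λ i → Σ ℕ (λ j → (i < j) × (j ≤ 3 ^ k) ×
      ((+ m) ∣ℤ (qt b c j ℤ.- qt b c i))))
lemma22 k b c b≢0 _ -2≤b 3∤bc b-even b-odd primes m 0<m m<3ᵏ⁺¹ =
  collision-below-3N 0<m (subst (m <_) (cong (3 ^_) (+-comm k 1)) m<3ᵏ⁺¹)
  where open Main k b c b≢0 -2≤b 3∤bc b-even b-odd primes
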